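{- A digraph is $1$-extremal if and only if it is a directed cycle.
   Context: Digraphs are finite, without loops or parallel arcs, but may contain digons. A $k$-dicolouring of $D$ is a map $V(D)\to\{1,\dots,k\}$ in which every colour class induces an acyclic subdigraph; $\vec{\chi}(D)$ is the least $k$ for which one exists. $\lambda_D(x,y)$ is the maximum number of pairwise arc-disjoint directed $xy$-paths and $\lambda(D)=\max_{x\ne y}\lambda_D(x,y)$. $D$ is strong if there is a directed path between any ordered pair of vertices; $D$ is biconnected if its underlying undirected graph is connected and has no cutvertex. For $k\ge1$, $D$ is $k$-extremal if it is biconnected, strong, and $\vec{\chi}(D)=\lambda(D)+1=k+1$. -}

module Defs where

open import Data.Nat using (ℕ; zero; suc; _+_; _≤_; _<_; _≥_)
open import Data.Nat.DivMod using (_mod_)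
open import Data.Fin using (Fin; zero; suc; toℕ; inject₁; fromℕ)
open import Data.Bool using (Bool; true; false; T)
open import Data.Product using (Σ; ∃; _×_; _,_)
open import Data.Sum using (_⊎_)
open import Relation.Binary.PropositionalEquality using (_≡_; _≢_)
open import Relation.Binary.Construct.Closure.ReflexiveTransitive using (Star)
open import Relation.Nullary using (¬_)
open import Function.Definitions using (Injective)
open import Function.Bundles using (Inverse; _↔_)
open import Data.Empty using (⊥)

-- Digraphs: vertex set Fin n, arcs given by a Boolean adjacency
-- relation (so no parallel arcs), no loops; digons allowed.

record Digraph (n : ℕ) : Set where
  field
    arc      : Fin n → Fin n → Bool
    loopless : ∀ x → arc x x ≡ false

open Digraph public

Arc : ∀ {n} → Digraph n → Fin n → Fin n → Set
Arc D x y = T (arc D x y)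

next : ∀ {m} → Fin (suc m) → Fin (suc m)
next {m} i = (suc (toℕ i)) mod (suc m)

record DCycle {n} (D : Digraph n) : Set where
  field
    m      : ℕ
    m≥1    : 1 ≤ m
    vtx    : Fin (suc m) → Fin n
    inj    : Injective _≡_ _≡_ vtx
    arcs   : ∀ i → Arc D (vtx i) (vtx (next i))

InducedAcyclic : ∀ {n} → Digraph n → (Fin n → Set) → Set
InducedAcyclic D S = ¬ (Σ (DCycle D) λ C → ∀ i → S (DCycle.vtx C i))

IsDicolouring : ∀ {n} → Digraph n → (k : ℕ) → (Fin n → Fin k) → Set
IsDicolouring D k c = ∀ (a : Fin k) → InducedAcyclic D (λ v → c v ≡ a)

Dicolourable : ∀ {n} → Digraph n → ℕ → Set
Dicolourable {n} D k = Σ (Fin n → Fin k) (IsDicolouring D k)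

DichromaticNumber : ∀ {n} → Digraph n → ℕ → Set
DichromaticNumber D k = Dicolourable D k × (∀ j → j < k → ¬ Dicolourable D j)

record DPath {n} (D : Digraph n) (x y : Fin n) : Set where
  field
    len   : ℕ
    vtx   : Fin (suc len) → Fin n
    inj   : Injective _≡_ _≡_ vtx
    start : vtx zero ≡ x
    end   : vtx (fromℕ len) ≡ y
    arcs  : ∀ (i : Fin len) → Arc D (vtx (inject₁ i)) (vtx (suc i))

UsesArc : ∀ {n} {D : Digraph n} {x y} → DPath D x y → Fin n → Fin n → Set
UsesArc P u v = ∃ λ (i : Fin (DPath.len P)) →
  (DPath.vtx P (inject₁ i) ≡ u) × (DPath.vtx P (suc i) ≡ v)

ArcDisjointPaths : ∀ {n} → Digraph n → Fin n → Fin n → ℕ → Set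
ArcDisjointPaths D x y p =
  Σ (Fin p → DPath D x y) λ P →
    ∀ a b → a ≢ b → ∀ u v → ¬ (UsesArc (P a) u v × UsesArc (P b) u v)

LocalArcConn : ∀ {n} → Digraph n → Fin n → Fin n → ℕ → Set
LocalArcConn D x y k = ArcDisjointPaths D x y k × ¬ ArcDisjointPaths D x y (suc k)

-- λ(D) = k : k is the maximum of λ_D(x,y) over x ≠ y
-- (taken to be 0 when there is no such pair)
ArcConn : ∀ {n} → Digraph n → ℕ → Set
ArcConn {n} D k =
  ((k ≡ 0) ⊎ (∃ λ x → ∃ λ y → x ≢ y × ArcDisjointPaths D x y k))
  × (∀ x y → x ≢ y → ¬ ArcDisjointPaths D x y (suc k))

Strong : ∀ {n} → Digraph n → Set
Strong {n} D = ∀ (x y : Fin n) → DPath D x y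

Adj : ∀ {n} → Digraph n → Fin n → Fin n → Set
Adj D x y = Arc D x y ⊎ Arc D y x

AdjAvoid : ∀ {n} → Digraph n → Fin n → Fin n → Fin n → Set
AdjAvoid D v x y = Adj D x y × x ≢ v × y ≢ v

UConnected : ∀ {n} → Digraph n → Set
UConnected {n} D = ∀ (x y : Fin n) → Star (Adj D) x y

-- v is a cutvertex: removing v disconnects two vertices that were connected
-- (i.e. removing v increases the number of components)
Cutvertex : ∀ {n} → Digraph n → Fin n → Set
Cutvertex D v = ∃ λ x → ∃ λ y → x ≢ v × y ≢ v ×
  Star (Adj D) x y × ¬ Star (AdjAvoid D v) x y

Biconnected : ∀ {n} → Digraph n → Set
Biconnected {n} D = UConnected D × (∀ (v : Fin n) → ¬ Cutvertex D v)

Extremal : ∀ {n} → ℕ → Digraph n → Set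
Extremal k D = Biconnected D × Strong D × DichromaticNumber D (suc k) × ArcConn D k

-- Directed cycle digraphs: C_{m+1} on Fin (suc m), arcs i → i+1 mod (m+1).
-- D is a directed cycle if it is isomorphic to C_n for some n ≥ 2.

cycleArc : ∀ {m} → Fin (suc m) → Fin (suc m) → Set
cycleArc i j = j ≡ next i

IsDirectedCycle : ∀ {n} → Digraph n → Set
IsDirectedCycle {zero} D = ⊥
IsDirectedCycle {suc m} D =
  1 ≤ m × Σ (Fin (suc m) ↔ Fin (suc m)) λ σ →
    ∀ i j → (Arc D (Inverse.to σ i) (Inverse.to σ j) → cycleArc i j)
          × (cycleArc i j → Arc D (Inverse.to σ i) (Inverse.to σ j))

-- A directed cycle has out-degree one, so all paths leaving a vertex share their first arc
-- (λ = 1), and giving a single vertex its own colour leaves only a directed path (χ⃗ = 2).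
-- Conversely, a 1-extremal D has a directed cycle C, being strong with two vertices (as χ⃗ = 2).
-- A walk avoiding the arcs of C between two distinct vertices of C would, together with C,
-- give two arc-disjoint paths; hence every arc lies on C, and all connections between a
-- vertex off C and C pass through a single vertex of C, which would then be a cutvertex.
-- So D is C.
module Submission where

open import Defs
open import Data.Nat using (ℕ; zero; suc; _≤_; _<_; z≤n; s≤s)
import Data.Nat.Properties as ℕₚ
open import Data.Nat.DivMod using (_%_; m<n⇒m%n≡m; n%n≡0)
open import Data.Fin using (Fin; zero; suc; toℕ; inject₁; fromℕ; _≟_)
import Data.Fin.Properties as Finₚ
open import Data.Product using (Σ; ∃; _×_; _,_; proj₁; proj₂; map₂; uncurry)
open import Data.Sum using (_⊎_; inj₁; inj₂)
open import Data.Bool using (T)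
open import Data.Unit using (⊤; tt)
open import Data.Empty using (⊥-elim)
open import Relation.Binary.PropositionalEquality
open import Relation.Binary.Construct.Closure.ReflexiveTransitive using (Star; ε; _◅_; _◅◅_; reverse)
open import Relation.Binary.Definitions using (tri<; tri≈; tri>)
open import Relation.Nullary using (¬_; Dec; yes; no)
open import Relation.Nullary.Decidable using (_×-dec_; _⊎-dec_)
open import Function using (_∘_; _$_; id)
open import Function.Definitions using (Injective)
open import Function.Bundles using (_⇔_; mk⇔; mk↔ₛ′; Inverse)

Fin1-trivial : (i : Fin 1) → i ≡ zero
Fin1-trivial zero = refl

data LastView : ∀ {m} → Fin (suc m) → Set where
  inner : ∀ {m} (q : Fin m) → LastView (inject₁ q)
  last  : ∀ {m} → LastView (fromℕ m)

lastView : ∀ {m} (i : Fin (suc m)) → LastView i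
lastView {zero}  zero    = last
lastView {suc m} zero    = inner zero
lastView {suc m} (suc i) with lastView i
... | inner q = inner (suc q)
... | last    = last

toℕ-next : ∀ {m} (i : Fin (suc m)) → toℕ (next i) ≡ suc (toℕ i) % suc m
toℕ-next i = Finₚ.toℕ-fromℕ< _

next-inject₁ : ∀ {m} (q : Fin m) → next (inject₁ q) ≡ suc q
next-inject₁ {m} q = Finₚ.toℕ-injective $ begin
  toℕ (next (inject₁ q))         ≡⟨ toℕ-next (inject₁ q) ⟩
  suc (toℕ (inject₁ q)) % suc m  ≡⟨ cong (λ k → suc k % suc m) (Finₚ.toℕ-inject₁ q) ⟩
  suc (toℕ q) % suc m            ≡⟨ m<n⇒m%n≡m (s≤s (Finₚ.toℕ<n q)) ⟩
  suc (toℕ q)                    ∎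
  where open ≡-Reasoning

next-fromℕ : ∀ m → next (fromℕ m) ≡ zero
next-fromℕ m = Finₚ.toℕ-injective $ begin
  toℕ (next (fromℕ m))         ≡⟨ toℕ-next (fromℕ m) ⟩
  suc (toℕ (fromℕ m)) % suc m  ≡⟨ cong (λ k → suc k % suc m) (Finₚ.toℕ-fromℕ m) ⟩
  suc m % suc m                ≡⟨ n%n≡0 (suc m) ⟩
  0                            ∎
  where open ≡-Reasoning

next≢id : ∀ {m} → 1 ≤ m → (i : Fin (suc m)) → next i ≢ i
next≢id {suc m} _ i with lastView i
... | inner q = λ e → ℕₚ.1+n≢n (trans (cong toℕ (trans (sym (next-inject₁ q)) e)) (Finₚ.toℕ-inject₁ q))
... | last    = λ e → Finₚ.0≢1+n (trans (sym (next-fromℕ (suc m))) e)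

toℕ-next-≢0 : ∀ {m} (i : Fin (suc m)) → next i ≢ zero → toℕ (next i) ≡ suc (toℕ i)
toℕ-next-≢0 i next≢0 with lastView i
... | inner q rewrite next-inject₁ q = cong suc (sym (Finₚ.toℕ-inject₁ q))
... | last    = ⊥-elim (next≢0 (next-fromℕ _))

module _ {A : Set} (R : A → A → Set) where

  linear-steps : ∀ {m} (f : Fin (suc m) → A) → (∀ i → R (f i) (f (next i))) →
                 ∀ q → R (f (inject₁ q)) (f (suc q))
  linear-steps f step q = subst (R (f (inject₁ q)) ∘ f) (next-inject₁ q) (step (inject₁ q))

  cyclic-steps : ∀ {m} (f : Fin (suc m) → A) → (∀ q → R (f (inject₁ q)) (f (suc q))) →
                 R (f (fromℕ m)) (f zero) → ∀ i → R (f i) (f (next i))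
  cyclic-steps f step close i with lastView i
  ... | inner q = subst (R (f (inject₁ q)) ∘ f) (sym (next-inject₁ q)) (step q)
  ... | last    = subst (R (f (fromℕ _)) ∘ f) (sym (next-fromℕ _)) close

  chain-walk : ∀ {k} (f : Fin (suc k) → A) {i j : Fin (suc k)} → toℕ i ≤ toℕ j →
               (∀ q → toℕ i ≤ toℕ (inject₁ q) → toℕ (suc q) ≤ toℕ j →
                      R (f (inject₁ q)) (f (suc q))) →
               Star R (f i) (f j)
  chain-walk f {zero} {zero} _ _ = ε
  chain-walk {suc k} f {zero} {suc j} _ step =
    step zero z≤n (s≤s z≤n)
    ◅ chain-walk (f ∘ suc) {zero} {j} z≤n (λ q _ q<j → step (suc q) z≤n (s≤s q<j))
  chain-walk {suc k} f {suc i} {suc j} (s≤s i≤j) step =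
    chain-walk (f ∘ suc) i≤j (λ q i≤q q<j → step (suc q) (s≤s i≤q) (s≤s q<j))

  cycle-walk : ∀ {m} (f : Fin (suc m) → A) → (∀ i → R (f i) (f (next i))) → ∀ i j → Star R (f i) (f j)
  cycle-walk {m} f step i j =
    chain-walk f (Finₚ.≤fromℕ i) (λ q _ _ → linear-steps f step q)
    ◅◅ subst (R (f (fromℕ m)) ∘ f) (next-fromℕ m) (step (fromℕ m))
    ◅ chain-walk f z≤n (λ q _ _ → linear-steps f step q)

module _ {n} {D : Digraph n} where

  arc⇒≢ : ∀ {u v} → Arc D u v → u ≢ v
  arc⇒≢ {u} a refl = subst T (loopless D u) a

  adjAvoid-sym : ∀ {c x y} → AdjAvoid D c x y → AdjAvoid D c y x
  adjAvoid-sym (inj₁ a , x≢c , y≢c) = inj₂ a , y≢c , x≢c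
  adjAvoid-sym (inj₂ a , x≢c , y≢c) = inj₁ a , y≢c , x≢c

  uses-arc : ∀ {x y} (P : DPath D x y) {u v} → UsesArc P u v → Arc D u v
  uses-arc P (i , refl , refl) = DPath.arcs P i

  first-arc : ∀ {x y} (P : DPath D x y) → x ≢ y → ∃ λ w → UsesArc P x w
  first-arc record { len = zero ; start = s ; end = e } x≢y = ⊥-elim (x≢y (trans (sym s) e))
  first-arc record { len = suc _ ; vtx = vtx ; start = s } _ = vtx (suc zero) , zero , s , refl

  path-walk : ∀ {x y} → DPath D x y → Star (Arc D) x y
  path-walk P = subst₂ (Star (Arc D)) start end (chain-walk (Arc D) vtx z≤n (λ q _ _ → arcs q))
    where open DPath P

  trivial-path : ∀ x → DPath D x x
  trivial-path x = record
    { len = 0 ; vtx = λ _ → x ; inj = λ { {zero} {zero} _ → refl } ; start = refl ; end = refl ; arcs = λ () }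

  cons-path : ∀ {x z y} → Arc D x z → (P : DPath D z y) → (∀ i → DPath.vtx P i ≢ x) → DPath D x y
  cons-path {x} a P x∉P = record
    { len = suc len ; vtx = vtx′ ; inj = inj′ ; start = refl ; end = end ; arcs = arcs′ }
    where
    open DPath P
    vtx′ : Fin (suc (suc len)) → Fin n
    vtx′ zero    = x
    vtx′ (suc i) = vtx i
    inj′ : Injective _≡_ _≡_ vtx′
    inj′ {zero}  {zero}  _ = refl
    inj′ {zero}  {suc j} e = ⊥-elim (x∉P j (sym e))
    inj′ {suc i} {zero}  e = ⊥-elim (x∉P i e)
    inj′ {suc i} {suc j} e = cong suc (inj e)
    arcs′ : ∀ i → Arc D (vtx′ (inject₁ i)) (vtx′ (suc i))
    arcs′ zero    = subst (Arc D x) (sym start) a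
    arcs′ (suc i) = arcs i

  closed-path⇒cycle : ∀ {x y} → Arc D y x → DPath D x y → DCycle D
  closed-path⇒cycle {x} {y} a P = record
    { m = len ; m≥1 = 1≤len ; vtx = vtx ; inj = inj
    ; arcs = cyclic-steps (Arc D) vtx arcs (subst₂ (Arc D) (sym end) (sym start) a) }
    where
    open DPath P
    1≤len : 1 ≤ len
    1≤len with first-arc P (arc⇒≢ a ∘ sym)
    ... | _ , i , _ = ℕₚ.≤-trans (s≤s z≤n) (Finₚ.toℕ<n i)

  strong⇒cycle : Strong D → ∀ {x y} → x ≢ y → DCycle D
  strong⇒cycle strong {x} {y} x≢y with first-arc (strong x y) x≢y
  ... | w , uses = closed-path⇒cycle (uses-arc (strong x y) uses) (strong w x)

  disjoint-pair : ∀ {x y} (P₁ P₂ : DPath D x y) → (∀ {u v} → UsesArc P₁ u v → ¬ UsesArc P₂ u v) →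
                  ArcDisjointPaths D x y 2
  disjoint-pair {x} {y} P₁ P₂ disjoint = paths , apart
    where
    paths : Fin 2 → DPath D x y
    paths zero    = P₁
    paths (suc _) = P₂
    apart : ∀ a b → a ≢ b → ∀ u v → ¬ (UsesArc (paths a) u v × UsesArc (paths b) u v)
    apart zero       zero       a≢b = ⊥-elim (a≢b refl)
    apart zero       (suc zero) _ _ _ (p , q) = disjoint p q
    apart (suc zero) zero       _ _ _ (p , q) = disjoint q p
    apart (suc zero) (suc zero) a≢b = ⊥-elim (a≢b refl)

ArcWith : ∀ {n} → Digraph n → (Fin n → Fin n → Set) → Fin n → Fin n → Set
ArcWith D Q u v = Arc D u v × Q u v

module _ {n} (D : Digraph n) (Q : Fin n → Fin n → Set) where

  private
    Walk = Star (ArcWith D Q)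

  OnWalk : Fin n → ∀ {x y} → Walk x y → Set
  OnWalk v {x} ε       = v ≡ x
  OnWalk v {x} (_ ◅ w) = v ≡ x ⊎ OnWalk v w

  on-walk? : ∀ v {x y} (w : Walk x y) → Dec (OnWalk v w)
  on-walk? v {x} ε       = v ≟ x
  on-walk? v {x} (_ ◅ w) = (v ≟ x) ⊎-dec on-walk? v w

  Simple : ∀ {x y} → Walk x y → Set
  Simple ε           = ⊤
  Simple {x} (_ ◅ w) = ¬ OnWalk x w × Simple w

  suffix : ∀ {v x y} (w : Walk x y) → OnWalk v w → Σ (Walk v y) λ w′ → Simple w → Simple w′
  suffix ε       refl        = ε , id
  suffix (s ◅ w) (inj₁ refl) = s ◅ w , id
  suffix (s ◅ w) (inj₂ v∈w)  = map₂ (_∘ proj₂) (suffix w v∈w)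

  loop-erase : ∀ {x y} → Walk x y → Σ (Walk x y) Simple
  loop-erase ε = ε , tt
  loop-erase {x} (s ◅ w) with loop-erase w
  ... | w′ , simple with on-walk? x w′
  ...   | yes x∈w′ = map₂ (_$ simple) (suffix w′ x∈w′)
  ...   | no  x∉w′ = s ◅ w′ , x∉w′ , simple

  simple⇒path : ∀ {x y} (w : Walk x y) → Simple w →
    Σ (DPath D x y) λ P → (∀ {u v} → UsesArc P u v → Q u v) × (∀ i → OnWalk (DPath.vtx P i) w)
  simple⇒path {x} ε _ = trivial-path x , (λ { (() , _) }) , λ _ → refl
  simple⇒path {x} ((a , q) ◅ w) (x∉w , simple) with simple⇒path w simple
  ... | P , P⊆Q , P⊆w = cons-path a P x∉P , uses , on
    where
    x∉P : ∀ i → DPath.vtx P i ≢ x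
    x∉P i e = x∉w (subst (λ v → OnWalk v w) e (P⊆w i))
    uses : ∀ {u v} → UsesArc (cons-path a P x∉P) u v → Q u v
    uses (zero , refl , refl) = subst (Q x) (sym (DPath.start P)) q
    uses (suc i , e)          = P⊆Q (i , e)
    on : ∀ i → OnWalk (DPath.vtx (cons-path a P x∉P) i) ((a , q) ◅ w)
    on zero    = inj₁ refl
    on (suc i) = inj₂ (P⊆w i)

  walk⇒path : ∀ {x y} → Walk x y → Σ (DPath D x y) λ P → ∀ {u v} → UsesArc P u v → Q u v
  walk⇒path w with loop-erase w
  ... | w′ , simple = map₂ proj₁ (simple⇒path w′ simple)

module _ {n} {D : Digraph n} where

  OnCycle : DCycle D → Fin n → Set
  OnCycle C v = ∃ λ i → DCycle.vtx C i ≡ v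

  CycleArc : DCycle D → Fin n → Fin n → Set
  CycleArc C u v = ∃ λ i → DCycle.vtx C i ≡ u × DCycle.vtx C (next i) ≡ v

  record Exhausts (C : DCycle D) : Set where
    field
      spanning        : ∀ v → OnCycle C v
      only-cycle-arcs : ∀ {u v} → Arc D u v → CycleArc C u v

  cycle-step-≢ : (C : DCycle D) → ∀ i → DCycle.vtx C i ≢ DCycle.vtx C (next i)
  cycle-step-≢ C i e = next≢id m≥1 i (sym (inj e))
    where open DCycle C

  acyclic⇒1-dicolourable : ¬ DCycle D → Dicolourable D 1
  acyclic⇒1-dicolourable acyclic = (λ _ → zero) , λ _ (C , _) → acyclic C

  no-cycle-increases : (φ : Fin n → ℕ) {b : ℕ} → (∀ v → φ v < b) → (C : DCycle D) →
                       ¬ (∀ i → φ (DCycle.vtx C i) < φ (DCycle.vtx C (next i)))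
  no-cycle-increases φ {b} bounded C increases = ℕₚ.<⇒≱ (bounded _) (proj₂ (reach b))
    where
    reach : ∀ k → ∃ λ i → k ≤ φ (DCycle.vtx C i)
    reach zero    = zero , z≤n
    reach (suc k) with reach k
    ... | i , k≤φi = next i , ℕₚ.≤-trans (s≤s k≤φi) (increases i)

module ForcedCycle {n} {D : Digraph n} (strong : Strong D) (biconnected : Biconnected D)
  (λ≤1 : ∀ x y → x ≢ y → ¬ ArcDisjointPaths D x y 2) (C : DCycle D) where
  open DCycle C

  on-cycle? : ∀ v → Dec (OnCycle C v)
  on-cycle? v = Finₚ.any? λ i → vtx i ≟ v

  cycle-arc? : ∀ u v → Dec (CycleArc C u v)
  cycle-arc? u v = Finₚ.any? λ i → (vtx i ≟ u) ×-dec (vtx (next i) ≟ v)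

  OffArc : Fin n → Fin n → Set
  OffArc u v = ¬ CycleArc C u v

  OffWalk : Fin n → Fin n → Set
  OffWalk = Star (ArcWith D OffArc)

  off-arc-into : ∀ {u v} → ¬ OnCycle C v → OffArc u v
  off-arc-into v∉C (i , _ , e) = v∉C (next i , e)

  off-arc-from : ∀ {u v} → ¬ OnCycle C u → OffArc u v
  off-arc-from u∉C (i , e , _) = u∉C (i , e)

  -- otherwise the off-cycle walk and the cycle itself give two arc-disjoint paths
  off-walk-trivial : ∀ {a b} → OnCycle C a → OnCycle C b → OffWalk a b → a ≡ b
  off-walk-trivial (i , refl) (j , refl) w with vtx i ≟ vtx j
  ... | yes e   = e
  ... | no  i≢j =
    ⊥-elim (λ≤1 _ _ i≢j (disjoint-pair (proj₁ off) (proj₁ on) λ p q → proj₂ off p (proj₂ on q)))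
    where
    off = walk⇒path D OffArc w
    on  = walk⇒path D (CycleArc C) (cycle-walk _ vtx (λ k → arcs k , k , refl , refl) i j)

  last-entry : ∀ {u z} → Star (Arc D) u z → ¬ OnCycle C z →
               (∃ λ a → OnCycle C a × OffWalk a z) ⊎ (¬ OnCycle C u × OffWalk u z)
  last-entry ε z∉C = inj₂ (z∉C , ε)
  last-entry {u} (a ◅ w) z∉C with last-entry w z∉C
  ... | inj₁ entry = inj₁ entry
  ... | inj₂ (u′∉C , w′) with on-cycle? u
  ...   | yes u∈C = inj₁ (u , u∈C , (a , off-arc-into u′∉C) ◅ w′)
  ...   | no  u∉C = inj₂ (u∉C , (a , off-arc-into u′∉C) ◅ w′)

  entry : ∀ {z} → ¬ OnCycle C z → ∃ λ a → OnCycle C a × OffWalk a z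
  entry z∉C with last-entry (path-walk (strong (vtx zero) _)) z∉C
  ... | inj₁ e        = e
  ... | inj₂ (v∉C , _) = ⊥-elim (v∉C (zero , refl))

  first-exit : ∀ {z v} → Star (Arc D) z v → OnCycle C v → ¬ OnCycle C z → ∃ λ b → OnCycle C b × OffWalk z b
  first-exit ε v∈C z∉C = ⊥-elim (z∉C v∈C)
  first-exit (_◅_ {j = z′} a w) v∈C z∉C with on-cycle? z′
  ... | yes z′∈C = z′ , z′∈C , (a , off-arc-from z∉C) ◅ ε
  ... | no  z′∉C = map₂ (map₂ ((a , off-arc-from z∉C) ◅_)) (first-exit w v∈C z′∉C)

  exit : ∀ {z} → ¬ OnCycle C z → ∃ λ b → OnCycle C b × OffWalk z b
  exit = first-exit (path-walk (strong _ (vtx zero))) (zero , refl)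

  Feeds : Fin n → Fin n → Set
  Feeds c w = ¬ OnCycle C w × OffWalk w c

  feeds-only : ∀ {b c w} → OnCycle C c → Feeds c w → OnCycle C b → OffWalk w b → b ≡ c
  feeds-only c∈C (w∉C , wc) b∈C wb with entry w∉C
  ... | e , e∈C , ew =
    trans (sym (off-walk-trivial e∈C b∈C (ew ◅◅ wb))) (off-walk-trivial e∈C c∈C (ew ◅◅ wc))

  feeds-step : ∀ {c w w′} → OnCycle C c → Feeds c w → AdjAvoid D c w w′ → Feeds c w′
  feeds-step {w′ = w′} c∈C fw@(w∉C , _) (inj₁ a , _ , w′≢c) with on-cycle? w′
  ... | yes w′∈C = ⊥-elim (w′≢c (feeds-only c∈C fw w′∈C ((a , off-arc-from w∉C) ◅ ε)))
  ... | no  w′∉C with exit w′∉C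
  ...   | b , b∈C , w′b =
    w′∉C , subst (OffWalk w′) (feeds-only c∈C fw b∈C ((a , off-arc-from w∉C) ◅ w′b)) w′b
  feeds-step {w′ = w′} c∈C (w∉C , wc) (inj₂ a , _ , w′≢c) with on-cycle? w′
  ... | yes w′∈C = ⊥-elim (w′≢c (off-walk-trivial w′∈C c∈C ((a , off-arc-into w∉C) ◅ wc)))
  ... | no  w′∉C = w′∉C , (a , off-arc-into w∉C) ◅ wc

  feeds-closed : ∀ {c w w′} → OnCycle C c → Star (AdjAvoid D c) w w′ → Feeds c w → Feeds c w′
  feeds-closed c∈C ε        fw = fw
  feeds-closed c∈C (s ◅ ss) fw = feeds-closed c∈C ss (feeds-step c∈C fw s)

  -- the vertex c at which a walk from an off-cycle vertex v first reaches C
  -- would separate v from the next vertex of C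
  spanning : ∀ v → OnCycle C v
  spanning v with on-cycle? v
  ... | yes v∈C = v∈C
  ... | no  v∉C with exit v∉C
  ...   | _ , (k , refl) , vc = ⊥-elim (proj₂ biconnected (vtx k)
          (v , vtx (next k) , (λ e → v∉C (k , sym e)) , cycle-step-≢ C k ∘ sym ,
           proj₁ biconnected _ _ , separated))
    where
    separated : ¬ Star (AdjAvoid D (vtx k)) v (vtx (next k))
    separated s = proj₁ (feeds-closed (k , refl) s (v∉C , vc)) (next k , refl)

  only-cycle-arcs : ∀ {u v} → Arc D u v → CycleArc C u v
  only-cycle-arcs {u} {v} a with cycle-arc? u v
  ... | yes uv∈C = uv∈C
  ... | no  uv∉C = ⊥-elim (arc⇒≢ {D = D} a (off-walk-trivial (spanning u) (spanning v) ((a , uv∉C) ◅ ε)))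

  exhausts : Exhausts C
  exhausts = record { spanning = spanning ; only-cycle-arcs = only-cycle-arcs }

module ExhaustedCycle {n} {D : Digraph n} (C : DCycle D) (E : Exhausts C) where
  open DCycle C renaming (vtx to f)
  open Exhausts E

  g : Fin n → Fin (suc m)
  g v = proj₁ (spanning v)

  f∘g : ∀ v → f (g v) ≡ v
  f∘g v = proj₂ (spanning v)

  g∘f : ∀ i → g (f i) ≡ i
  g∘f i = inj (f∘g (f i))

  g-injective : Injective _≡_ _≡_ g
  g-injective {u} {v} e = trans (sym (f∘g u)) (trans (cong f e) (f∘g v))

  out-arc-target : ∀ {u w} → Arc D u w → w ≡ f (next (g u))
  out-arc-target a with only-cycle-arcs a
  ... | i , refl , refl = cong (f ∘ next) (sym (g∘f i))

  walk-around : (R : Fin n → Fin n → Set) → (∀ i → R (f i) (f (next i))) → ∀ x y → Star R x y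
  walk-around R step x y = subst₂ (Star R) (f∘g x) (f∘g y) (cycle-walk R f step (g x) (g y))

  strong : Strong D
  strong x y = proj₁ (walk⇒path D (λ _ _ → ⊤) (walk-around _ (λ i → arcs i , tt) x y))

  uconnected : UConnected D
  uconnected = walk-around (Adj D) (inj₁ ∘ arcs)

  module Avoiding (v : Fin n) where
    p : Fin (suc m)
    p = g v

    avoids : ∀ {t} → t ≢ p → f t ≢ v
    avoids t≢p e = t≢p (trans (sym (g∘f _)) (cong g e))

    above : ∀ {t} → toℕ p < toℕ t → t ≢ p
    above p<t t≡p = ℕₚ.<⇒≢ p<t (cong toℕ (sym t≡p))

    below : ∀ {t} → toℕ t < toℕ p → t ≢ p
    below t<p t≡p = ℕₚ.<⇒≢ t<p (cong toℕ t≡p)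

    segment : ∀ {i j} → toℕ i ≤ toℕ j → (∀ t → toℕ i ≤ toℕ t → toℕ t ≤ toℕ j → t ≢ p) →
              Star (AdjAvoid D v) (f i) (f j)
    segment i≤j clear = chain-walk _ f i≤j λ q i≤q q<j →
      inj₁ (linear-steps (Arc D) f arcs q) ,
      avoids (clear _ i≤q (ℕₚ.≤-trans (ℕₚ.≤-reflexive (Finₚ.toℕ-inject₁ q)) (ℕₚ.<⇒≤ q<j))) ,
      avoids (clear _ (Finₚ.i≤inject₁[j]⇒i≤1+j i≤q) q<j)

    wrap : fromℕ m ≢ p → zero ≢ p → AdjAvoid D v (f (fromℕ m)) (f zero)
    wrap last≢p zero≢p =
      inj₁ (subst (Arc D (f (fromℕ m)) ∘ f) (next-fromℕ m) (arcs (fromℕ m))) , avoids last≢p , avoids zero≢p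

    -- when p lies between a and b, go round the other way, through the arc from the last vertex to the first
    ordered-walk : ∀ {a b} → toℕ a ≤ toℕ b → a ≢ p → b ≢ p → Star (AdjAvoid D v) (f a) (f b)
    ordered-walk {a} {b} a≤b a≢p b≢p with ℕₚ.<-cmp (toℕ p) (toℕ a) | ℕₚ.<-cmp (toℕ p) (toℕ b)
    ... | tri< p<a _ _ | _            = segment a≤b λ t a≤t _ → above (ℕₚ.<-≤-trans p<a a≤t)
    ... | tri≈ _ p≡a _ | _            = ⊥-elim (a≢p (Finₚ.toℕ-injective (sym p≡a)))
    ... | tri> _ _ _   | tri≈ _ p≡b _ = ⊥-elim (b≢p (Finₚ.toℕ-injective (sym p≡b)))
    ... | tri> _ _ _   | tri> _ _ b<p = segment a≤b λ t _ t≤b → below (ℕₚ.≤-<-trans t≤b b<p)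
    ... | tri> _ _ a<p | tri< p<b _ _ = reverse (adjAvoid-sym {D = D})
          (segment (Finₚ.≤fromℕ b) (λ t b≤t _ → above (ℕₚ.<-≤-trans p<b b≤t))
           ◅◅ wrap (above (ℕₚ.<-≤-trans p<b (Finₚ.≤fromℕ b))) (below (ℕₚ.≤-<-trans z≤n a<p))
           ◅ segment z≤n (λ t _ t≤a → below (ℕₚ.≤-<-trans t≤a a<p)))

  no-cutvertex : ∀ v → ¬ Cutvertex D v
  no-cutvertex v (x , y , x≢v , y≢v , _ , separated) =
    separated (subst₂ (Star (AdjAvoid D v)) (f∘g x) (f∘g y) connect)
    where
    open Avoiding v
    connect : Star (AdjAvoid D v) (f (g x)) (f (g y))
    connect with ℕₚ.≤-total (toℕ (g x)) (toℕ (g y))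
    ... | inj₁ x≤y = ordered-walk x≤y (x≢v ∘ g-injective) (y≢v ∘ g-injective)
    ... | inj₂ y≤x = reverse (adjAvoid-sym {D = D}) (ordered-walk y≤x (y≢v ∘ g-injective) (x≢v ∘ g-injective))

  arc-connectivity : ArcConn D 1
  arc-connectivity = inj₂ (f zero , f (next zero) , cycle-step-≢ C zero , one-path) , at-most-one
    where
    one-path : ArcDisjointPaths D (f zero) (f (next zero)) 1
    one-path = (λ _ → strong _ _) , λ { zero zero 0≢0 → ⊥-elim (0≢0 refl) }
    -- every path leaving x starts with the only arc out of x
    at-most-one : ∀ x y → x ≢ y → ¬ ArcDisjointPaths D x y 2
    at-most-one x y x≢y (P , disjoint) =
      disjoint zero (suc zero) (λ ()) x _ (uses-out-arc (P zero) , uses-out-arc (P (suc zero)))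
      where
      uses-out-arc : (Q : DPath D x y) → UsesArc Q x (f (next (g x)))
      uses-out-arc Q with first-arc Q x≢y
      ... | _ , uses = subst (UsesArc Q x) (out-arc-target (uses-arc Q uses)) uses

  pin : Fin (suc m) → Fin 2
  pin zero    = zero
  pin (suc _) = suc zero

  colour : Fin n → Fin 2
  colour = pin ∘ g

  colour-zero-acyclic : InducedAcyclic D (λ v → colour v ≡ zero)
  colour-zero-acyclic (C′ , coloured) = cycle-step-≢ C′ zero (g-injective (trans (at-zero _) (sym (at-zero _))))
    where
    at-zero : ∀ i → g (DCycle.vtx C′ i) ≡ zero
    at-zero i with g (DCycle.vtx C′ i) | coloured i
    ... | zero | _ = refl

  -- a colour-1 cycle avoids f 0, so g never wraps round along it and climbs by one at every step
  colour-one-acyclic : InducedAcyclic D (λ v → colour v ≡ suc zero)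
  colour-one-acyclic (C′ , coloured) = no-cycle-increases (toℕ ∘ g) (Finₚ.toℕ<n ∘ g) C′ climbs
    where
    open DCycle C′ using () renaming (vtx to h; arcs to h-arcs)
    g-step : ∀ i → g (h (next i)) ≡ next (g (h i))
    g-step i = trans (cong g (out-arc-target (h-arcs i))) (g∘f _)
    nonzero : ∀ i → next (g (h i)) ≢ zero
    nonzero i e with subst (λ t → pin t ≡ suc zero) (trans (g-step i) e) (coloured (next i))
    ... | ()
    climbs : ∀ i → toℕ (g (h i)) < toℕ (g (h (next i)))
    climbs i = ℕₚ.≤-reflexive (sym (trans (cong toℕ (g-step i)) (toℕ-next-≢0 _ (nonzero i))))

  dichromatic-number : DichromaticNumber D 2
  dichromatic-number = (colour , λ { zero → colour-zero-acyclic ; (suc zero) → colour-one-acyclic }) , fewer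
    where
    fewer : ∀ j → j < 2 → ¬ Dicolourable D j
    fewer zero          _               (c , _)           = Finₚ.¬Fin0 (c (f zero))
    fewer (suc zero)    _               (c , dicolouring) = dicolouring zero (C , Fin1-trivial ∘ c ∘ f)
    fewer (suc (suc _)) (s≤s (s≤s ()))

  extremal : Extremal 1 D
  extremal = (uconnected , no-cutvertex) , strong , dichromatic-number , arc-connectivity

exhausting-cycle⇒IsDirectedCycle : ∀ {n} {D : Digraph n} (C : DCycle D) → Exhausts C → IsDirectedCycle D
exhausting-cycle⇒IsDirectedCycle {zero}  C _ = Finₚ.¬Fin0 (DCycle.vtx C zero)
exhausting-cycle⇒IsDirectedCycle {suc k} {D} C@record { m = m ; m≥1 = 1≤m ; vtx = f ; inj = inj ; arcs = arcs } E
  with Finₚ.cantor-schröder-bernstein inj (ExhaustedCycle.g-injective C E)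
... | refl = 1≤m , mk↔ₛ′ f g f∘g g∘f , λ i j → arc⇒next i j , λ { refl → arcs i }
  where
  open ExhaustedCycle C E using (g; f∘g; g∘f)
  arc⇒next : ∀ i j → Arc D (f i) (f j) → j ≡ next i
  arc⇒next i j a with Exhausts.only-cycle-arcs E a
  ... | l , fl≡fi , fl⁺≡fj = trans (sym (inj fl⁺≡fj)) (cong next (inj fl≡fi))

IsDirectedCycle⇒exhausting-cycle : ∀ {n} {D : Digraph n} → IsDirectedCycle D → Σ (DCycle D) Exhausts
IsDirectedCycle⇒exhausting-cycle {suc m} {D} (1≤m , σ , arc⇔) = C , record
  { spanning        = λ v → from v , strictlyInverseˡ v
  ; only-cycle-arcs = λ {u} {v} a → from u , strictlyInverseˡ u , next-from a }
  where
  open Inverse σ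
  C : DCycle D
  C = record
    { m = m ; m≥1 = 1≤m ; vtx = to
    ; inj = λ {i} {j} e → trans (sym (strictlyInverseʳ i)) (trans (cong from e) (strictlyInverseʳ j))
    ; arcs = λ i → proj₂ (arc⇔ i (next i)) refl }
  next-from : ∀ {u v} → Arc D u v → to (next (from u)) ≡ v
  next-from {u} {v} a = trans (cong to (sym (proj₁ (arc⇔ (from u) (from v)) a′))) (strictlyInverseˡ v)
    where
    a′ : Arc D (to (from u)) (to (from v))
    a′ = subst₂ (Arc D) (sym (strictlyInverseˡ u)) (sym (strictlyInverseˡ v)) a

strong-2-dichromatic⇒cycle : ∀ {n} {D : Digraph n} → Strong D → DichromaticNumber D 2 → DCycle D
strong-2-dichromatic⇒cycle {zero}        _      (_ , fewer) =
  ⊥-elim (fewer 1 ℕₚ.≤-refl (acyclic⇒1-dicolourable λ C → Finₚ.¬Fin0 (DCycle.vtx C zero)))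
strong-2-dichromatic⇒cycle {suc zero}    _      (_ , fewer) =
  ⊥-elim (fewer 1 ℕₚ.≤-refl (acyclic⇒1-dicolourable λ C →
    cycle-step-≢ C zero (trans (Fin1-trivial _) (sym (Fin1-trivial _)))))
strong-2-dichromatic⇒cycle {suc (suc _)} strong _ = strong⇒cycle strong {zero} {suc zero} (λ ())

extremal⇒exhausting-cycle : ∀ {n} {D : Digraph n} → Extremal 1 D → Σ (DCycle D) Exhausts
extremal⇒exhausting-cycle (biconnected , strong , χ≡2 , _ , λ≤1) =
  C , ForcedCycle.exhausts strong biconnected λ≤1 C
  where
  C = strong-2-dichromatic⇒cycle strong χ≡2

theorem4p2 : ∀ {n : ℕ} (D : Digraph n) → Extremal 1 D ⇔ IsDirectedCycle D
theorem4p2 D = mk⇔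
  (uncurry exhausting-cycle⇒IsDirectedCycle ∘ extremal⇒exhausting-cycle)
  (uncurry ExhaustedCycle.extremal ∘ IsDirectedCycle⇒exhausting-cycle)
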